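{- For every decorated tree $T$, the labeled tree $\varphi_T(T)$ equals the $\beta$-(1,0) tree $\phi_T(T)$.
   Context: $\beta$-(1,0) trees: rooted plane trees with at least one edge, with a positive integer label on every node, every leaf labeled $1$, root label equal to the sum of the labels of its children, every other internal node labeled between $1$ and the sum of its children's labels; $\operatorname{root}(B)$ is the root label; $B_0$ is the one-edge tree. $\Delta_{\mathcal B}(B,i)$ ($1\le i\le\operatorname{root}(B)$): attach the root of $B$ as only child of a new root and label both old and new root $i$. $\oplus_{\mathcal B}(B_1,i,B_2)$ ($1\le i\le\operatorname{root}(B_1)$): add the root of $B_1$ with its subtree, relabeled $i$, as new leftmost child of the root of $B_2$, and relabel the root $i+\operatorname{root}(B_2)$. $L(B)$: add a new leaf as leftmost child of the root and increase the root label by $1$. Decorated trees: depth of the root is $0$, traversal order is preorder (left-to-right). A decorated tree is a rooted plane tree with at least one edge, each leaf labeled by an integer $\ge-1$, such that (1) each leaf label is strictly less than the depth of its parent; (2) every internal node of depth $p>0$ has a descendant leaf labeled $\le p-2$; (3) for every internal node $t$ of depth $p$, every subtree $T''$ rooted at a child of $t$ and every leaf $\ell$ of $T''$ labeled $p$, the leaves of $T''$ preceding $\ell$ have labels $\ge p$. Free leaves are those labeled $-1$; $\operatorname{fl}(T)$ counts them. $\Pi_{\mathcal T}(T)$ (root with one child) deletes the root and subtracts $1$ from every non-free leaf label. $\phi_T$ is defined recursively: root with a single leaf child: $\phi_T(T)=B_0$; root with a single internal child: $\phi_T(T)=\Delta_{\mathcal B}(\phi_T(\Pi_{\mathcal T}(T)),\operatorname{fl}(T))$;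 root with $\ge2$ children, leftmost a leaf: $\phi_T(T)=L(\phi_T(T'))$, $T'$ being $T$ without that leaf; root with $\ge2$ children, leftmost internal: with $T_{hd}$ = root + leftmost child + its subtree and $T_{tl}$ = root + other children + their subtrees, $\phi_T(T)=\oplus_{\mathcal B}(\phi_T(\Pi_{\mathcal T}(T_{hd})),\operatorname{fl}(T_{hd}),\phi_T(T_{tl}))$. $\varphi_T(T)$ is the tree with the same underlying plane tree as $T$, where each internal node of depth $p>0$ is labeled by the number of its descendant leaves with label at most $p-2$, the root is labeled $\operatorname{fl}(T)$, and every leaf is labeled $1$. -}

module Defs where

open import Data.Nat using (ℕ; zero; suc; _+_)
open import Data.Integer as ℤ using (ℤ; +_; -[1+_]; _-_)
open import Data.List using (List; []; _∷_; _++_)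
open import Data.List.Relation.Unary.All using (All)
open import Data.List.Relation.Unary.Any using (Any)
open import Data.Product using (_×_)
open import Data.Unit using (⊤)
open import Data.Empty using (⊥)
open import Relation.Nullary using (¬_; yes; no)
open import Relation.Binary.PropositionalEquality using (_≡_)

-- Plane trees whose leaves carry integer labels (underlying shape of
-- decorated trees).  An internal node is `node cs`; decorated trees
-- require cs to be nonempty (so `node []` never occurs).

data Tree : Set where
  leaf : ℤ → Tree
  node : List Tree → Tree

minus1 : ℤ
minus1 = -[1+ 0 ]

mutual
  leaves : Tree → List ℤ
  leaves (leaf l)  = l ∷ []
  leaves (node cs) = leavesF cs

  leavesF : List Tree → List ℤ
  leavesF []       = []
  leavesF (c ∷ cs) = leaves c ++ leavesF cs

mutual
  size : Tree → ℕ
  size (leaf _)  = 1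
  size (node cs) = suc (sizeF cs)

  sizeF : List Tree → ℕ
  sizeF []       = 0
  sizeF (c ∷ cs) = size c + sizeF cs

countFree : List ℤ → ℕ
countFree []       = 0
countFree (l ∷ ls) with l ℤ.≟ minus1
... | yes _ = suc (countFree ls)
... | no  _ = countFree ls

countLe : ℤ → List ℤ → ℕ
countLe b []       = 0
countLe b (l ∷ ls) with l ℤ.≤? b
... | yes _ = suc (countLe b ls)
... | no  _ = countLe b ls

flF : List Tree → ℕ
flF cs = countFree (leavesF cs)

fl : Tree → ℕ
fl t = countFree (leaves t)

leafChildOK : ℕ → Tree → Set
leafChildOK p (leaf l) = (minus1 ℤ.≤ l) × (l ℤ.< + p)
leafChildOK p (node _) = ⊤

LocalOK : ℕ → List Tree → Set
LocalOK p cs =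
  ¬ (cs ≡ [])
  × All (leafChildOK p) cs
  × (0 Data.Nat.< p → Any (λ l → l ℤ.≤ (+ p) - (+ 2)) (leavesF cs))
  × All (λ c → ∀ xs ys → leaves c ≡ xs ++ ((+ p) ∷ ys)
                → All (λ x → (+ p) ℤ.≤ x) xs) cs

mutual
  -- LocalOK at every internal node; the argument is the depth of the node
  AllInternal : ℕ → Tree → Set
  AllInternal p (leaf _)  = ⊤
  AllInternal p (node cs) = LocalOK p cs × AllInternalF (suc p) cs

  AllInternalF : ℕ → List Tree → Set
  AllInternalF q []       = ⊤
  AllInternalF q (c ∷ cs) = AllInternal q c × AllInternalF q cs

IsDecorated : Tree → Set
IsDecorated (leaf _)  = ⊥          -- at least one edge
IsDecorated (node cs) = AllInternal 0 (node cs)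

data BTree : Set where
  bnode : ℕ → List BTree → BTree

root : BTree → ℕ
root (bnode n _) = n

relabelRoot : ℕ → BTree → BTree
relabelRoot i (bnode _ cs) = bnode i cs

B₀ : BTree
B₀ = bnode 1 (bnode 1 [] ∷ [])

ΔB : BTree → ℕ → BTree
ΔB B i = bnode i (relabelRoot i B ∷ [])

⊕B : BTree → ℕ → BTree → BTree
⊕B B₁ i (bnode r cs) = bnode (i + r) (relabelRoot i B₁ ∷ cs)

LB : BTree → BTree
LB (bnode r cs) = bnode (suc r) (bnode 1 [] ∷ cs)

-- Π_T: delete the root (with single child `node ds`) and subtract 1 from
-- every non-free leaf label.  We act on the child list ds of the new root.

decLabel : ℤ → ℤ
decLabel l with l ℤ.≟ minus1
... | yes _ = l
... | no  _ = l - (+ 1)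

mutual
  decT : Tree → Tree
  decT (leaf l)  = leaf (decLabel l)
  decT (node cs) = node (decF cs)

  decF : List Tree → List Tree
  decF []       = []
  decF (c ∷ cs) = decT c ∷ decF cs

-- φ_T, on the tree whose root has children cs, with fuel (the fuel
-- size T suffices: each recursive call strictly decreases the size).
phiF : ℕ → List Tree → BTree
phiF zero    _                    = B₀
phiF (suc n) []                   = B₀   -- not a tree with an edge; junk
phiF (suc n) (leaf _ ∷ [])        = B₀
phiF (suc n) (node ds ∷ [])       =
  ΔB (phiF n (decF ds)) (flF (node ds ∷ []))
phiF (suc n) (leaf _ ∷ c ∷ cs)    = LB (phiF n (c ∷ cs))
phiF (suc n) (node ds ∷ c ∷ cs)   =
  ⊕B (phiF n (decF ds)) (flF (node ds ∷ [])) (phiF n (c ∷ cs))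

phiT : Tree → BTree
phiT (leaf _)  = B₀                      -- junk (not a decorated tree)
phiT (node cs) = phiF (size (node cs)) cs

mutual
  -- node at depth p (p > 0)
  varphiAt : ℕ → Tree → BTree
  varphiAt p (leaf _)  = bnode 1 []
  varphiAt p (node cs) = bnode (countLe ((+ p) - (+ 2)) (leavesF cs)) (varphiF (suc p) cs)

  varphiF : ℕ → List Tree → List BTree
  varphiF q []       = []
  varphiF q (c ∷ cs) = varphiAt q c ∷ varphiF q cs

varphiT : Tree → BTree
varphiT (leaf _)  = bnode 1 []
varphiT (node cs) = bnode (flF cs) (varphiF 1 cs)

-- Only condition (1) and the nonemptiness of internal nodes matter.  Under
-- them Π_T lowers every non-free leaf label by one exactly as the depth of
-- every node drops by one, so varphi_T commutes with Π_T; in particular the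
-- label fl(T_hd) that φ_T puts on the root of φ_T(Π_T(T_hd)) is the label
-- varphi_T gives the leftmost child of T.  Free leaves are additive over the
-- children, and a leaf child of the root is free.  Hence varphi_T satisfies
-- the four recursive equations defining φ_T, and the two agree by
-- induction on the size of T.
module Submission where

open import Defs

open import Data.Nat as ℕ using (ℕ; zero; suc; _+_; z≤n; s≤s)
open import Data.Nat.Properties using (≤-refl; ≤-trans; m≤n+m; m+n≤o⇒m≤o)
open import Data.Integer as ℤ using (ℤ; +_; -[1+_]; _-_; -≤+; +≤+; -≤-; -<+; +<+)
open import Data.List using (List; []; _∷_; _++_; map)
open import Data.List.Properties using (map-++; ++-identityʳ)
open import Data.List.Relation.Unary.All using (All; []; _∷_)
open import Data.List.Relation.Unary.All.Properties using (++⁺)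
open import Data.Product using (_×_; _,_)
open import Data.Unit using (⊤; tt)
open import Data.Empty using (⊥-elim)
open import Function.Bundles using (_⇔_; mk⇔; Equivalence)
open import Relation.Nullary using (¬_; yes; no)
open import Relation.Binary.PropositionalEquality
  using (_≡_; refl; sym; trans; cong; cong₂; subst; module ≡-Reasoning)

-- The index d is the depth of the parent of the subtree.
mutual
  Bounded : ℕ → Tree → Set
  Bounded d (leaf l)  = (minus1 ℤ.≤ l) × (l ℤ.< + d)
  Bounded d (node cs) = ¬ (cs ≡ []) × BoundedF (suc d) cs

  BoundedF : ℕ → List Tree → Set
  BoundedF d []       = ⊤
  BoundedF d (c ∷ cs) = Bounded d c × BoundedF d cs

mutual
  allInternal⇒bounded : ∀ p t → leafChildOK p t → AllInternal (suc p) t → Bounded p t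
  allInternal⇒bounded p (leaf l)  ok _                        = ok
  allInternal⇒bounded p (node cs) _  ((ne , oks , _ , _) , ai) =
    ne , allInternalF⇒boundedF (suc p) cs oks ai

  allInternalF⇒boundedF : ∀ p cs → All (leafChildOK p) cs → AllInternalF (suc p) cs → BoundedF p cs
  allInternalF⇒boundedF p []       []         _        = tt
  allInternalF⇒boundedF p (c ∷ cs) (ok ∷ oks) (a , as) =
    allInternal⇒bounded p c ok a , allInternalF⇒boundedF p cs oks as

mutual
  bounded⇒leaves≥-1 : ∀ d t → Bounded d t → All (minus1 ℤ.≤_) (leaves t)
  bounded⇒leaves≥-1 d (leaf l)  (-1≤l , _) = -1≤l ∷ []
  bounded⇒leaves≥-1 d (node cs) (_ , b)    = boundedF⇒leavesF≥-1 (suc d) cs b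

  boundedF⇒leavesF≥-1 : ∀ d cs → BoundedF d cs → All (minus1 ℤ.≤_) (leavesF cs)
  boundedF⇒leavesF≥-1 d []       _        = []
  boundedF⇒leavesF≥-1 d (c ∷ cs) (b , bs) =
    ++⁺ (bounded⇒leaves≥-1 d c b) (boundedF⇒leavesF≥-1 d cs bs)

minus1≤l<0⇒l≡minus1 : ∀ {l} → minus1 ℤ.≤ l → l ℤ.< + 0 → l ≡ minus1
minus1≤l<0⇒l≡minus1 { -[1+ zero ]}  _         _          = refl
minus1≤l<0⇒l≡minus1 { -[1+ suc _ ]} (-≤- ()) _
minus1≤l<0⇒l≡minus1 {+ _}          _         (+<+ ())

decLabel-bounded : ∀ d {l} → minus1 ℤ.≤ l → l ℤ.< + suc d →
                   (minus1 ℤ.≤ decLabel l) × (decLabel l ℤ.< + d)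
decLabel-bounded d { -[1+ zero ]}  _        _               = -≤- z≤n , -<+
decLabel-bounded d { -[1+ suc _ ]} (-≤- ()) _
decLabel-bounded d {+ zero}       _        _               = -≤- z≤n , -<+
decLabel-bounded d {+ suc _}      _        (+<+ (s≤s l<d)) = -≤+ , +<+ l<d

-- (+ suc q) - (+ 2) is the integer q - 1.
decLabel≤q-1⇔≤q : ∀ q {l} → minus1 ℤ.≤ l → decLabel l ℤ.≤ (+ suc q) - (+ 2) ⇔ l ℤ.≤ + q
decLabel≤q-1⇔≤q q {l} -1≤l = mk⇔ (to q l -1≤l) (from q l -1≤l)
  where
  to : ∀ q l → minus1 ℤ.≤ l → decLabel l ℤ.≤ (+ suc q) - (+ 2) → l ℤ.≤ + q
  to q       -[1+ zero ]  _        _        = -≤+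
  to q       -[1+ suc _ ] (-≤- ()) _
  to q       (+ zero)     _        _        = +≤+ z≤n
  to zero    (+ suc _)    _        ()
  to (suc q) (+ suc _)    _        (+≤+ le) = +≤+ (s≤s le)

  from : ∀ q l → minus1 ℤ.≤ l → l ℤ.≤ + q → decLabel l ℤ.≤ (+ suc q) - (+ 2)
  from zero    -[1+ zero ]  _        _               = -≤- z≤n
  from (suc q) -[1+ zero ]  _        _               = -≤+
  from q       -[1+ suc _ ] (-≤- ()) _
  from zero    (+ zero)     _        _               = -≤- z≤n
  from (suc q) (+ zero)     _        _               = -≤+
  from zero    (+ suc _)    _        (+≤+ ())
  from (suc q) (+ suc _)    _        (+≤+ (s≤s le)) = +≤+ le

countLe-map : ∀ {P : ℤ → Set} (f : ℤ → ℤ) {a b} →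
              (∀ {l} → P l → f l ℤ.≤ a ⇔ l ℤ.≤ b) →
              ∀ {ls} → All P ls → countLe a (map f ls) ≡ countLe b ls
countLe-map f {a} {b} f≤a⇔≤b {[]}     []       = refl
countLe-map f {a} {b} f≤a⇔≤b {l ∷ ls} (p ∷ ps) with f l ℤ.≤? a | l ℤ.≤? b
... | yes _   | yes _   = cong suc (countLe-map f f≤a⇔≤b ps)
... | no  _   | no  _   = countLe-map f f≤a⇔≤b ps
... | yes f≤a | no  l≰b = ⊥-elim (l≰b (Equivalence.to (f≤a⇔≤b p) f≤a))
... | no  f≰a | yes l≤b = ⊥-elim (f≰a (Equivalence.from (f≤a⇔≤b p) l≤b))

countLe-minus1≡countFree : ∀ {ls} → All (minus1 ℤ.≤_) ls → countLe minus1 ls ≡ countFree ls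
countLe-minus1≡countFree {[]}                []               = refl
countLe-minus1≡countFree { -[1+ zero ] ∷ ls}  (_ ∷ ps)         = cong suc (countLe-minus1≡countFree ps)
countLe-minus1≡countFree { -[1+ suc _ ] ∷ ls} (-≤- () ∷ _)
countLe-minus1≡countFree {+ _ ∷ ls}          (_ ∷ ps)         = countLe-minus1≡countFree ps

countFree-++ : ∀ xs ys → countFree (xs ++ ys) ≡ countFree xs + countFree ys
countFree-++ []       ys = refl
countFree-++ (x ∷ xs) ys with x ℤ.≟ minus1
... | yes _ = cong suc (countFree-++ xs ys)
... | no  _ = countFree-++ xs ys

flF-∷ : ∀ c cs → flF (c ∷ cs) ≡ flF (c ∷ []) + flF cs
flF-∷ c cs = begin
  countFree (leaves c ++ leavesF cs)            ≡⟨ countFree-++ (leaves c) (leavesF cs) ⟩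
  countFree (leaves c) + flF cs                 ≡⟨ cong (λ ls → countFree ls + flF cs) (sym (++-identityʳ (leaves c))) ⟩
  countFree (leaves c ++ []) + flF cs           ∎
  where open ≡-Reasoning

mutual
  size-decT : ∀ t → size (decT t) ≡ size t
  size-decT (leaf _)  = refl
  size-decT (node cs) = cong suc (sizeF-decF cs)

  sizeF-decF : ∀ cs → sizeF (decF cs) ≡ sizeF cs
  sizeF-decF []       = refl
  sizeF-decF (c ∷ cs) = cong₂ _+_ (size-decT c) (sizeF-decF cs)

mutual
  leaves-decT : ∀ t → leaves (decT t) ≡ map decLabel (leaves t)
  leaves-decT (leaf _)  = refl
  leaves-decT (node cs) = leavesF-decF cs

  leavesF-decF : ∀ cs → leavesF (decF cs) ≡ map decLabel (leavesF cs)
  leavesF-decF []       = refl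
  leavesF-decF (c ∷ cs) =
    trans (cong₂ _++_ (leaves-decT c) (leavesF-decF cs)) (sym (map-++ decLabel (leaves c) (leavesF cs)))

decF-≢[] : ∀ {cs} → ¬ (cs ≡ []) → ¬ (decF cs ≡ [])
decF-≢[] {[]}    cs≢[] _ = cs≢[] refl
decF-≢[] {_ ∷ _} _       ()

mutual
  decT-bounded : ∀ d t → Bounded (suc d) t → Bounded d (decT t)
  decT-bounded d (leaf l)  (-1≤l , l<d) = decLabel-bounded d -1≤l l<d
  decT-bounded d (node cs) (ne , b)     = decF-≢[] ne , decF-boundedF (suc d) cs b

  decF-boundedF : ∀ d cs → BoundedF (suc d) cs → BoundedF d (decF cs)
  decF-boundedF d []       _        = tt
  decF-boundedF d (c ∷ cs) (b , bs) = decT-bounded d c b , decF-boundedF d cs bs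

mutual
  varphiAt-decT : ∀ q t → Bounded (suc q) t → varphiAt (suc q) (decT t) ≡ varphiAt (suc (suc q)) t
  varphiAt-decT q (leaf _)  _       = refl
  varphiAt-decT q (node cs) (_ , b) = cong₂ bnode count (varphiF-decF (suc q) cs b)
    where
    count : countLe ((+ suc q) - (+ 2)) (leavesF (decF cs)) ≡ countLe (+ q) (leavesF cs)
    count = trans (cong (countLe _) (leavesF-decF cs))
                  (countLe-map decLabel (decLabel≤q-1⇔≤q q) (boundedF⇒leavesF≥-1 (suc (suc q)) cs b))

  varphiF-decF : ∀ q cs → BoundedF (suc q) cs → varphiF (suc q) (decF cs) ≡ varphiF (suc (suc q)) cs
  varphiF-decF q []       _        = refl
  varphiF-decF q (c ∷ cs) (b , bs) = cong₂ _∷_ (varphiAt-decT q c b) (varphiF-decF q cs bs)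

varphiAt-node≡varphiT-Π : ∀ ds → BoundedF 1 ds →
  varphiAt 1 (node ds) ≡ relabelRoot (flF (node ds ∷ [])) (varphiT (node (decF ds)))
varphiAt-node≡varphiT-Π ds b = cong₂ bnode label (sym (varphiF-decF 0 ds b))
  where
  label : countLe minus1 (leavesF ds) ≡ countFree (leavesF ds ++ [])
  label = trans (countLe-minus1≡countFree (boundedF⇒leavesF≥-1 1 ds b))
                (cong countFree (sym (++-identityʳ (leavesF ds))))

mutual
  varphiT≡phiF : ∀ n cs → size (node cs) ℕ.≤ n → ¬ (cs ≡ []) → BoundedF 0 cs →
                 varphiT (node cs) ≡ phiF n cs
  varphiT≡phiF zero    cs                 ()      _  _
  varphiT≡phiF (suc n) []                 _       ne _ = ⊥-elim (ne refl)
  varphiT≡phiF (suc n) (leaf l ∷ [])      _       _  ((-1≤l , l<0) , _)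
    rewrite minus1≤l<0⇒l≡minus1 -1≤l l<0 = refl
  varphiT≡phiF (suc n) (node ds ∷ [])     (s≤s le) _  ((ne , b) , _) = begin
    bnode i (varphiAt 1 (node ds) ∷ [])   ≡⟨ cong (λ B → bnode i (B ∷ [])) (varphiAt-node≡varphiT-Π ds b) ⟩
    ΔB (varphiT (node (decF ds))) i       ≡⟨ cong (λ B → ΔB B i) (varphiT≡phiF-Π n ds (m+n≤o⇒m≤o _ le) ne b) ⟩
    ΔB (phiF n (decF ds)) i               ∎
    where open ≡-Reasoning
          i = flF (node ds ∷ [])
  varphiT≡phiF (suc n) (leaf l ∷ c ∷ cs)  (s≤s le) _  ((-1≤l , l<0) , b)
    rewrite minus1≤l<0⇒l≡minus1 -1≤l l<0 = cong LB (varphiT≡phiF n (c ∷ cs) le (λ ()) b)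
  varphiT≡phiF (suc n) (node ds ∷ c ∷ cs) (s≤s le) _  ((ne , b) , bs) = begin
    bnode (flF (node ds ∷ c ∷ cs)) (varphiAt 1 (node ds) ∷ varphiF 1 (c ∷ cs))
      ≡⟨ cong₂ (λ r B → bnode r (B ∷ varphiF 1 (c ∷ cs))) (flF-∷ (node ds) (c ∷ cs)) (varphiAt-node≡varphiT-Π ds b) ⟩
    ⊕B (varphiT (node (decF ds))) i (varphiT (node (c ∷ cs)))
      ≡⟨ cong₂ (λ B₁ B₂ → ⊕B B₁ i B₂) (varphiT≡phiF-Π n ds (m+n≤o⇒m≤o _ le) ne b)
                                       (varphiT≡phiF n (c ∷ cs) (≤-trans (s≤s (m≤n+m _ (sizeF ds))) le) (λ ()) bs) ⟩
    ⊕B (phiF n (decF ds)) i (phiF n (c ∷ cs))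
      ∎
    where open ≡-Reasoning
          i = flF (node ds ∷ [])

  varphiT≡phiF-Π : ∀ n ds → size (node ds) ℕ.≤ n → ¬ (ds ≡ []) → BoundedF 1 ds →
                   varphiT (node (decF ds)) ≡ phiF n (decF ds)
  varphiT≡phiF-Π n ds le ne b =
    varphiT≡phiF n (decF ds) (subst (ℕ._≤ n) (sym (size-decT (node ds))) le) (decF-≢[] ne) (decF-boundedF 0 ds b)

proposition3p4 : (T : Tree) → IsDecorated T → varphiT T ≡ phiT T
proposition3p4 (leaf _)  ()
proposition3p4 (node cs) ((ne , oks , _ , _) , ai) =
  varphiT≡phiF (size (node cs)) cs ≤-refl ne (allInternalF⇒boundedF 0 cs oks ai)
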